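{- Let $\hat H$ be a $2$-tree, let $e_0$ be an edge of $\hat H$, and let $\alpha=T(\hat H)$ and $\beta=T(\hat H;e_0)$. Let $p\ge 1$. Set $G_0=\hat H$, and for $i=1,\ldots,p$ let $G_i$ be obtained from $G_{i-1}$ by adding a new vertex $w_i$ adjacent exactly to the two endpoints of an edge $e_{i-1}$ of $G_{i-1}$, where $e_0$ is the given edge and, for $i\ge 2$, $e_{i-1}$ is an edge of $G_{i-1}$ incident to $w_{i-1}$. Let $e_p$ be either of the two edges of $G_p$ incident to $w_p$. Then, with $t_p=T(G_p)$ and $s_p=T(G_p;e_p)$, $$t_p=F_{2p+1}\alpha+F_{2p}\beta \qquad\text{and}\qquad s_p=F_{2p}\alpha+F_{2p-1}\beta.$$
   Context: A $2$-tree is a graph obtained from the graph consisting of two adjacent vertices by iteratively adding one new vertex whose neighborhood consists of two adjacent vertices. For a graph $G$, $T(G)$ is the number of spanning trees of $G$, and for an edge $e$, $T(G;e)$ is the number of spanning trees of $G$ containing $e$. The Fibonacci sequence is $F_0=0$, $F_1=1$, $F_m=F_{m-1}+F_{m-2}$ for $m\ge 2$. -}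

module Defs where

open import Data.Nat using (ℕ; zero; suc; _+_)
open import Data.Fin using (Fin; zero; suc; inject₁; fromℕ)
open import Data.Fin.Subset using (Subset; _∈_; _-_)
open import Data.Product using (_×_; _,_; Σ; proj₁; proj₂)
open import Data.Sum using (_⊎_)
open import Data.Vec using (Vec; []; _∷_)
open import Relation.Binary.PropositionalEquality using (_≡_)
open import Relation.Nullary using (¬_)
open import Function.Bundles using (_↔_)

F : ℕ → ℕ
F zero = 0
F (suc zero) = 1
F (suc (suc m)) = F (suc m) + F m

-- A finite graph with vertex set Fin order and edge set Fin size;
-- edge i joins the two vertices  ends i  (undirected).
record Graph : Set where
  field
    order : ℕ
    size  : ℕ
    ends  : Fin size → Fin order × Fin order
open Graph public

Edge : Graph → Set
Edge G = Fin (size G)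

K2 : Graph
K2 = record { order = 2 ; size = 1 ; ends = λ _ → (zero , suc zero) }

-- The two new edges are  zero  (w to the first
-- endpoint of e) and  suc zero  (w to the second endpoint of e); the old
-- edge i becomes  suc (suc i).
addVertex : (G : Graph) → Edge G → Graph
addVertex G e = record
  { order = suc (order G)
  ; size  = suc (suc (size G))
  ; ends  = ends′
  }
  where
  w : Fin (suc (order G))
  w = fromℕ (order G)
  ends′ : Fin (suc (suc (size G))) → Fin (suc (order G)) × Fin (suc (order G))
  ends′ zero = (w , inject₁ (proj₁ (ends G e)))
  ends′ (suc zero) = (w , inject₁ (proj₂ (ends G e)))
  ends′ (suc (suc i)) = (inject₁ (proj₁ (ends G i)) , inject₁ (proj₂ (ends G i)))

newEdge : {G : Graph} {e : Edge G} → Fin 2 → Edge (addVertex G e)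
newEdge zero = zero
newEdge (suc zero) = suc zero

-- 2-trees (with a concrete vertex labelling; every 2-tree is isomorphic to one of these).
data TwoTree : Graph → Set where
  base : TwoTree K2
  step : {G : Graph} → TwoTree G → (e : Edge G) → TwoTree (addVertex G e)

data Reach (G : Graph) (S : Subset (size G)) (u : Fin (order G)) : Fin (order G) → Set where
  here : Reach G S u u
  via  : {v x : Fin (order G)} → Reach G S u v → (i : Edge G) → i ∈ S →
         (ends G i ≡ (v , x)) ⊎ (ends G i ≡ (x , v)) → Reach G S u x

Connected : (G : Graph) → Subset (size G) → Set
Connected G S = (u v : Fin (order G)) → Reach G S u v

-- The spanning subgraph with edge set S has no cycle: no edge of S lies on a
-- cycle, i.e. its endpoints are not joined by a path in S without that edge.
Acyclic : (G : Graph) → Subset (size G) → Set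
Acyclic G S = (i : Edge G) → i ∈ S → ¬ Reach G (S - i) (proj₁ (ends G i)) (proj₂ (ends G i))

-- A spanning tree: edge set S that is connected and acyclic (proof irrelevant,
-- so a spanning tree is determined by its edge set).
record SpanningTree (G : Graph) : Set where
  constructor mkST
  field
    edgeSet : Subset (size G)
    .connected : Connected G edgeSet
    .acyclic   : Acyclic G edgeSet
open SpanningTree public

SpanningTreeWith : (G : Graph) → Edge G → Set
SpanningTreeWith G e = Σ (SpanningTree G) λ T → e ∈ edgeSet T

HasCount : Set → ℕ → Set
HasCount A k = Fin k ↔ A

NumSpanningTrees : Graph → ℕ → Set
NumSpanningTrees G k = HasCount (SpanningTree G) k

NumSpanningTreesWith : (G : Graph) → Edge G → ℕ → Set
NumSpanningTreesWith G e k = HasCount (SpanningTreeWith G e) k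

-- Iterated construction: starting from (G₀, e₀), with choices c₁ … c_p,
-- G_i = addVertex G_{i-1} e_{i-1}, and e_i = the new edge of G_i selected by c_i
-- (one of the two edges incident to w_i).
chain : (G : Graph) → Edge G → {p : ℕ} → Vec (Fin 2) p → Σ Graph Edge
chain G e [] = (G , e)
chain G e (c ∷ cs) = chain (addVertex G e) (newEdge {G} {e} c) cs

module Submission where

-- Split the spanning trees of G′ = addVertex G e by the new edges wu, wv they contain.  With
-- exactly one of them, w is a leaf and deleting it leaves a spanning tree of G; with both,
-- replacing the path u w v by e gives a spanning tree of G through e; with neither, w is
-- isolated.  Hence T(G′) = 2 T(G) + T(G;e) and T(G′;wu) = T(G′;wv) = T(G) + T(G;e).  The map
-- (t , s) ↦ (2t + s , t + s) is the square of the Fibonacci matrix, so p steps from (α , β)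
-- advance the Fibonacci indices by 2p.

open import Defs
import Data.Empty.Irrelevant as Irrelevant
open import Data.Fin using (Fin; zero; suc; inject₁; fromℕ; toℕ; lower₁)
open import Data.Fin.Properties
  using (toℕ-fromℕ; toℕ-injective; toℕ-inject₁-≢; inject₁-lower₁; lower₁-inject₁′; fromℕ≢inject₁; +↔⊎; *↔×)
  renaming (_≟_ to _≟ᶠ_)
open import Data.Fin.Subset using (Subset; inside; outside; _∈_; _∉_; _⊆_; _-_; _∪_; ⁅_⁆; ⊥)
open import Data.Fin.Subset.Properties
  using ( ⊆-refl; ⊆-antisym; x∈⁅x⁆; x∈⁅y⁆⇒x≡y; ∉⊥; p⊆p∪q; x∈p∪q⁺; x∈p∪q⁻; p─q⊆p
        ; x∈p∧x∉q⇒x∈p─q; x∈p∧x≢y⇒x∈p-y)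
open import Data.Nat using (ℕ; zero; suc; _+_; _*_; _∸_; _≥_)
import Data.Nat as ℕ
open import Data.Nat.GeneralisedArithmetic using (iterate)
open import Data.Nat.Tactic.RingSolver using (solve-∀)
open import Data.Product using (_×_; _,_; Σ; ∃; proj₁; proj₂)
open import Data.Product.Function.NonDependent.Propositional using (_×-↔_)
open import Data.Sum using (_⊎_; inj₁; inj₂)
open import Data.Sum.Function.Propositional using (_⊎-↔_)
open import Data.Vec using (Vec; []; _∷_; here; there)
open import Data.Vec.Properties.WithK using ([]=-irrelevant)
open import Function.Base using (id)
open import Function.Bundles using (_↔_; mk↔ₛ′)
open import Function.Properties.Inverse using (↔-refl; ↔-sym; ↔-trans)
open import Relation.Binary.PropositionalEquality
open import Relation.Nullary using (¬_; yes; no; contradiction)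

module _ {G : Graph} {S : Subset (size G)} where

  Reach-trans : ∀ {x y z} → Reach G S x y → Reach G S y z → Reach G S x z
  Reach-trans r here = r
  Reach-trans r (via r′ i i∈S adj) = via (Reach-trans r r′) i i∈S adj

  Reach-ends : (i : Edge G) → i ∈ S → Reach G S (proj₁ (ends G i)) (proj₂ (ends G i))
  Reach-ends i i∈S = via here i i∈S (inj₁ refl)

  Reach-ends⁻ : (i : Edge G) → i ∈ S → Reach G S (proj₂ (ends G i)) (proj₁ (ends G i))
  Reach-ends⁻ i i∈S = via here i i∈S (inj₂ refl)

  Reach-sym : ∀ {x y} → Reach G S x y → Reach G S y x
  Reach-sym here = here
  Reach-sym (via r i i∈S (inj₁ refl)) = Reach-trans (Reach-ends⁻ i i∈S) (Reach-sym r)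
  Reach-sym (via r i i∈S (inj₂ refl)) = Reach-trans (Reach-ends i i∈S) (Reach-sym r)

Reach-map : ∀ {G H : Graph} {S : Subset (size G)} {T : Subset (size H)}
  (f : Fin (order G) → Fin (order H)) →
  (∀ i → i ∈ S → Reach H T (f (proj₁ (ends G i))) (f (proj₂ (ends G i)))) →
  ∀ {x y} → Reach G S x y → Reach H T (f x) (f y)
Reach-map f f-edge here = here
Reach-map f f-edge (via r i i∈S (inj₁ refl)) = Reach-trans (Reach-map f f-edge r) (f-edge i i∈S)
Reach-map f f-edge (via r i i∈S (inj₂ refl)) = Reach-trans (Reach-map f f-edge r) (Reach-sym (f-edge i i∈S))

Reach-mono : ∀ {G : Graph} {S T : Subset (size G)} → S ⊆ T → ∀ {x y} → Reach G S x y → Reach G T x y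
Reach-mono S⊆T = Reach-map id (λ i i∈S → Reach-ends i (S⊆T i∈S))

private
  variable
    n : ℕ

x∉p-x : (x : Fin n) (p : Subset n) → x ∉ p - x
x∉p-x zero    (s ∷ p) ()
x∉p-x (suc x) (s ∷ p) (there x∈p-x) = x∉p-x x p x∈p-x

x∈p-y⇒x≢y : ∀ {x y} {p : Subset n} → x ∈ p - y → x ≢ y
x∈p-y⇒x≢y {x = x} {p = p} x∈p-x refl = x∉p-x x p x∈p-x

x∈p-y⇒x∈p : ∀ {x y} {p : Subset n} → x ∈ p - y → x ∈ p
x∈p-y⇒x∈p {y = y} {p} = p─q⊆p p ⁅ y ⁆

p-x-y⊆p-y : ∀ {x y} (p : Subset n) → p - x - y ⊆ p - y
p-x-y⊆p-y p z∈ = x∈p∧x≢y⇒x∈p-y (x∈p-y⇒x∈p (x∈p-y⇒x∈p z∈)) (x∈p-y⇒x≢y z∈)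

p∪q-x⊆p-x∪q : ∀ {x} (p q : Subset n) → (p ∪ q) - x ⊆ (p - x) ∪ q
p∪q-x⊆p-x∪q p q z∈ with x∈p∪q⁻ p q (x∈p-y⇒x∈p z∈)
... | inj₁ z∈p = x∈p∪q⁺ (inj₁ (x∈p∧x≢y⇒x∈p-y z∈p (x∈p-y⇒x≢y z∈)))
... | inj₂ z∈q = x∈p∪q⁺ (inj₂ z∈q)

x∈p∪⁅x⁆ : (x : Fin n) (p : Subset n) → x ∈ p ∪ ⁅ x ⁆
x∈p∪⁅x⁆ x p = x∈p∪q⁺ (inj₂ (x∈⁅x⁆ x))

p∪⁅x⁆-x⊆p : ∀ {x} (p : Subset n) → (p ∪ ⁅ x ⁆) - x ⊆ p
p∪⁅x⁆-x⊆p {x = x} p z∈ with x∈p∪q⁻ p ⁅ x ⁆ (x∈p-y⇒x∈p z∈)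
... | inj₁ z∈p   = z∈p
... | inj₂ z∈⁅x⁆ = contradiction (x∈⁅y⁆⇒x≡y x z∈⁅x⁆) (x∈p-y⇒x≢y z∈)

p⊆p-x∪⁅x⁆ : ∀ {x} (p : Subset n) → p ⊆ (p - x) ∪ ⁅ x ⁆
p⊆p-x∪⁅x⁆ {x = x} p {z} z∈p with z ≟ᶠ x
... | yes refl = x∈p∪⁅x⁆ x (p - x)
... | no z≢x   = x∈p∪q⁺ (inj₁ (x∈p∧x≢y⇒x∈p-y z∈p z≢x))

p∪⁅x⁆-x≡p : ∀ {x} (p : Subset n) → x ∉ p → (p ∪ ⁅ x ⁆) - x ≡ p
p∪⁅x⁆-x≡p {x = x} p x∉p = ⊆-antisym (p∪⁅x⁆-x⊆p p) p⊆p∪⁅x⁆-x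
  where
  p⊆p∪⁅x⁆-x : p ⊆ (p ∪ ⁅ x ⁆) - x
  p⊆p∪⁅x⁆-x z∈p = x∈p∧x≢y⇒x∈p-y (p⊆p∪q ⁅ x ⁆ z∈p) λ { refl → x∉p z∈p }

p-x∪⁅x⁆≡p : ∀ {x} (p : Subset n) → x ∈ p → (p - x) ∪ ⁅ x ⁆ ≡ p
p-x∪⁅x⁆≡p {x = x} p x∈p = ⊆-antisym p-x∪⁅x⁆⊆p (p⊆p-x∪⁅x⁆ p)
  where
  p-x∪⁅x⁆⊆p : (p - x) ∪ ⁅ x ⁆ ⊆ p
  p-x∪⁅x⁆⊆p z∈ with x∈p∪q⁻ (p - x) ⁅ x ⁆ z∈
  ... | inj₁ z∈p-x = x∈p-y⇒x∈p z∈p-x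
  ... | inj₂ z∈⁅x⁆ = subst (_∈ p) (sym (x∈⁅y⁆⇒x≡y x z∈⁅x⁆)) x∈p


fromℕ-or-inject₁ : ∀ {n} (x : Fin (suc n)) → x ≡ fromℕ n ⊎ ∃ λ y → x ≡ inject₁ y
fromℕ-or-inject₁ {n} x with n ℕ.≟ toℕ x
... | yes n≡x = inj₁ (toℕ-injective (trans (sym n≡x) (sym (toℕ-fromℕ n))))
... | no n≢x  = inj₂ (lower₁ x n≢x , sym (inject₁-lower₁ x n≢x))

collapse : ∀ {n} → Fin n → Fin (suc n) → Fin n
collapse {n} d x with n ℕ.≟ toℕ x
... | yes _   = d
... | no n≢x  = lower₁ x n≢x

collapse-fromℕ : ∀ {n} (d : Fin n) → collapse d (fromℕ n) ≡ d
collapse-fromℕ {n} d with n ℕ.≟ toℕ (fromℕ n)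
... | yes _   = refl
... | no n≢n  = contradiction (sym (toℕ-fromℕ n)) n≢n

collapse-inject₁ : ∀ {n} (d x : Fin n) → collapse d (inject₁ x) ≡ x
collapse-inject₁ {n} d x with n ℕ.≟ toℕ (inject₁ x)
... | yes n≡x = contradiction n≡x (toℕ-inject₁-≢ x)
... | no n≢x  = lower₁-inject₁′ x n≢x

mkST-cong : ∀ {G : Graph} {S T : Subset (size G)} .{cS aS cT aT} → S ≡ T → mkST {G} S cS aS ≡ mkST T cT aT
mkST-cong refl = refl

SpanningTreeWith-≡ : ∀ {G : Graph} {i : Edge G} {X Y : SpanningTreeWith G i} → proj₁ X ≡ proj₁ Y → X ≡ Y
SpanningTreeWith-≡ {X = T , i∈T} {.T , i∈T′} refl = cong (T ,_) ([]=-irrelevant i∈T i∈T′)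

module AddVertex (G : Graph) (e : Edge G) where

  G′ : Graph
  G′ = addVertex G e

  u v : Fin (order G)
  u = proj₁ (ends G e)
  v = proj₂ (ends G e)

  w : Fin (order G′)
  w = fromℕ (order G)

  ι : Fin (order G) → Fin (order G′)
  ι = inject₁

  lift : ∀ {a b} {S : Subset (size G)} {x y} → Reach G S x y → Reach G′ (a ∷ b ∷ S) (ι x) (ι y)
  lift = Reach-map ι (λ i i∈S → Reach-ends (suc (suc i)) (there (there i∈S)))

  -- Contracting w onto d needs the edges wu and wv to become paths d ~ u and d ~ v.
  project : ∀ {a b} {S T : Subset (size G)} (d : Fin (order G)) →
    (a ≡ inside → Reach G T d u) → (b ≡ inside → Reach G T d v) → S ⊆ T →
    ∀ {x y} → Reach G′ (a ∷ b ∷ S) x y → Reach G T (collapse d x) (collapse d y)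
  project {a} {b} {S} {T} d d~u d~v S⊆T = Reach-map (collapse d) edge
    where
    edge : ∀ i → i ∈ a ∷ b ∷ S → Reach G T (collapse d (proj₁ (ends G′ i))) (collapse d (proj₂ (ends G′ i)))
    edge zero here = subst₂ (Reach G T) (sym (collapse-fromℕ d)) (sym (collapse-inject₁ d u)) (d~u refl)
    edge (suc zero) (there here) =
      subst₂ (Reach G T) (sym (collapse-fromℕ d)) (sym (collapse-inject₁ d v)) (d~v refl)
    edge (suc (suc j)) (there (there j∈S)) =
      subst₂ (Reach G T) (sym (collapse-inject₁ d _)) (sym (collapse-inject₁ d _)) (Reach-ends j (S⊆T j∈S))

  project-ι : ∀ {a b} {S T : Subset (size G)} (d : Fin (order G)) →
    (a ≡ inside → Reach G T d u) → (b ≡ inside → Reach G T d v) → S ⊆ T →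
    ∀ {x y} → Reach G′ (a ∷ b ∷ S) (ι x) (ι y) → Reach G T x y
  project-ι {T = T} d d~u d~v S⊆T {x} {y} r =
    subst₂ (Reach G T) (collapse-inject₁ d x) (collapse-inject₁ d y) (project d d~u d~v S⊆T r)

  project-w : ∀ {a b} {S T : Subset (size G)} (d : Fin (order G)) →
    (a ≡ inside → Reach G T d u) → (b ≡ inside → Reach G T d v) → S ⊆ T →
    ∀ {y} → Reach G′ (a ∷ b ∷ S) w (ι y) → Reach G T d y
  project-w {T = T} d d~u d~v S⊆T {y} r =
    subst₂ (Reach G T) (collapse-fromℕ d) (collapse-inject₁ d y) (project d d~u d~v S⊆T r)

  w-isolated : ∀ {S : Subset (size G)} {y} → Reach G′ (outside ∷ outside ∷ S) w y → y ≡ w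
  w-isolated here = refl
  w-isolated (via r zero () _)
  w-isolated (via r (suc zero) (there ()) _)
  w-isolated (via r (suc (suc j)) _ (inj₁ refl)) = contradiction (sym (w-isolated r)) fromℕ≢inject₁
  w-isolated (via r (suc (suc j)) _ (inj₂ refl)) = contradiction (sym (w-isolated r)) fromℕ≢inject₁

  w-unreachable : ∀ {S : Subset (size G)} {x} → ¬ Reach G′ (outside ∷ outside ∷ S) w (ι x)
  w-unreachable r = fromℕ≢inject₁ (sym (w-isolated r))

  connected-via : ∀ {S′ : Subset (size G′)} (z : Fin (order G)) →
    (∀ x y → Reach G′ S′ (ι x) (ι y)) → Reach G′ S′ w (ι z) → Connected G′ S′
  connected-via {S′} z old-connected w~z x y = Reach-trans (Reach-sym (from-z x)) (from-z y)
    where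
    from-z : ∀ x → Reach G′ S′ (ι z) x
    from-z x with fromℕ-or-inject₁ x
    ... | inj₁ refl       = Reach-sym w~z
    ... | inj₂ (x′ , refl) = old-connected z x′

  pendant : Fin 2 → Subset (size G) → Subset (size G′)
  pendant zero       S = inside ∷ outside ∷ S
  pendant (suc zero) S = outside ∷ inside ∷ S

  pendant-connected : ∀ c S → Connected G S → Connected G′ (pendant c S)
  pendant-connected zero       S conn = connected-via u (λ x y → lift (conn x y)) (Reach-ends zero here)
  pendant-connected (suc zero) S conn =
    connected-via v (λ x y → lift (conn x y)) (Reach-ends (suc zero) (there here))

  pendant-acyclic : ∀ c S → Acyclic G S → Acyclic G′ (pendant c S)
  pendant-acyclic zero S acyc zero _ r = w-unreachable r
  pendant-acyclic zero S acyc (suc zero) (there ())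
  pendant-acyclic zero S acyc (suc (suc i)) (there (there i∈S)) r =
    acyc i i∈S (project-ι u (λ _ → here) (λ ()) ⊆-refl r)
  pendant-acyclic (suc zero) S acyc zero ()
  pendant-acyclic (suc zero) S acyc (suc zero) _ r = w-unreachable r
  pendant-acyclic (suc zero) S acyc (suc (suc i)) (there (there i∈S)) r =
    acyc i i∈S (project-ι v (λ ()) (λ _ → here) ⊆-refl r)

  unpendant-connected : ∀ c S → Connected G′ (pendant c S) → Connected G S
  unpendant-connected zero       S conn x y = project-ι u (λ _ → here) (λ ()) ⊆-refl (conn (ι x) (ι y))
  unpendant-connected (suc zero) S conn x y = project-ι v (λ ()) (λ _ → here) ⊆-refl (conn (ι x) (ι y))

  unpendant-acyclic : ∀ c S → Acyclic G′ (pendant c S) → Acyclic G S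
  unpendant-acyclic zero       S acyc i i∈S r = acyc (suc (suc i)) (there (there i∈S)) (lift r)
  unpendant-acyclic (suc zero) S acyc i i∈S r = acyc (suc (suc i)) (there (there i∈S)) (lift r)

  u~v-through-w : ∀ {S : Subset (size G)} → Reach G′ (inside ∷ inside ∷ S) (ι u) (ι v)
  u~v-through-w = Reach-trans (Reach-ends⁻ zero here) (Reach-ends (suc zero) (there here))

  -- The edge e is simulated by the path u w v.
  lift-bridged : ∀ {S T : Subset (size G)} → T ⊆ S ∪ ⁅ e ⁆ →
    ∀ {x y} → Reach G T x y → Reach G′ (inside ∷ inside ∷ S) (ι x) (ι y)
  lift-bridged {S} {T} T⊆S∪e = Reach-map ι edge
    where
    edge : ∀ j → j ∈ T → Reach G′ (inside ∷ inside ∷ S) (ι (proj₁ (ends G j))) (ι (proj₂ (ends G j)))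
    edge j j∈T with x∈p∪q⁻ S ⁅ e ⁆ (T⊆S∪e j∈T)
    ... | inj₁ j∈S = Reach-ends (suc (suc j)) (there (there j∈S))
    ... | inj₂ j∈e rewrite x∈⁅y⁆⇒x≡y e j∈e = u~v-through-w

  bridged-connected : ∀ T → Connected G T → Connected G′ (inside ∷ inside ∷ (T - e))
  bridged-connected T conn =
    connected-via u (λ x y → lift-bridged (p⊆p-x∪⁅x⁆ T) (conn x y)) (Reach-ends zero here)

  bridged-acyclic : ∀ T → e ∈ T → Acyclic G T → Acyclic G′ (inside ∷ inside ∷ (T - e))
  bridged-acyclic T e∈T acyc zero _ r =
    acyc e e∈T (Reach-sym (project-w v (λ ()) (λ _ → here) (p─q⊆p (T - e) ⊥) r))
  bridged-acyclic T e∈T acyc (suc zero) _ r =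
    acyc e e∈T (project-w u (λ _ → here) (λ ()) (p─q⊆p (T - e) ⊥) r)
  bridged-acyclic T e∈T acyc (suc (suc i)) (there (there i∈T-e)) r =
    acyc i (x∈p-y⇒x∈p i∈T-e) (project-ι u (λ _ → here) (λ _ → Reach-ends e e∈T-i) (p-x-y⊆p-y T) r)
    where
    e∈T-i : e ∈ T - i
    e∈T-i = x∈p∧x≢y⇒x∈p-y e∈T (λ e≡i → x∈p-y⇒x≢y i∈T-e (sym e≡i))

  bridged-acyclic⇒e∉ : ∀ {S} → Acyclic G′ (inside ∷ inside ∷ S) → e ∉ S
  bridged-acyclic⇒e∉ acyc e∈S = acyc zero here
    (Reach-trans (Reach-ends (suc zero) (there here))
                 (Reach-ends⁻ (suc (suc e)) (there (there (x∈p∧x∉q⇒x∈p─q e∈S ∉⊥)))))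

  unbridged-connected : ∀ S → Connected G′ (inside ∷ inside ∷ S) → Connected G (S ∪ ⁅ e ⁆)
  unbridged-connected S conn x y =
    project-ι u (λ _ → here) (λ _ → Reach-ends e (x∈p∪⁅x⁆ e S)) (p⊆p∪q ⁅ e ⁆) (conn (ι x) (ι y))

  unbridged-acyclic : ∀ S → Acyclic G′ (inside ∷ inside ∷ S) → Acyclic G (S ∪ ⁅ e ⁆)
  unbridged-acyclic S acyc i i∈S∪e r with i ≟ᶠ e
  ... | yes refl = acyc zero here
    (Reach-trans (Reach-ends (suc zero) (there here))
                 (Reach-sym (lift (Reach-mono (λ j∈ → x∈p∧x∉q⇒x∈p─q (p∪⁅x⁆-x⊆p S j∈) ∉⊥) r))))
  ... | no i≢e with x∈p∪q⁻ S ⁅ e ⁆ i∈S∪e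
  ...   | inj₁ i∈S = acyc (suc (suc i)) (there (there i∈S)) (lift-bridged (p∪q-x⊆p-x∪q S ⁅ e ⁆) r)
  ...   | inj₂ i∈e = contradiction (x∈⁅y⁆⇒x≡y e i∈e) i≢e

  addPendant : Fin 2 → SpanningTree G → SpanningTree G′
  addPendant c (mkST S conn acyc) = mkST (pendant c S) (pendant-connected c S conn) (pendant-acyclic c S acyc)

  removePendant : ∀ c S → .(Connected G′ (pendant c S)) → .(Acyclic G′ (pendant c S)) → SpanningTree G
  removePendant c S conn acyc = mkST S (unpendant-connected c S conn) (unpendant-acyclic c S acyc)

  bridge : SpanningTreeWith G e → SpanningTree G′
  bridge (mkST T conn acyc , e∈T) =
    mkST (inside ∷ inside ∷ (T - e)) (bridged-connected T conn) (bridged-acyclic T e∈T acyc)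

  unbridge : ∀ S → .(Connected G′ (inside ∷ inside ∷ S)) → .(Acyclic G′ (inside ∷ inside ∷ S)) →
    SpanningTreeWith G e
  unbridge S conn acyc =
    mkST (S ∪ ⁅ e ⁆) (unbridged-connected S conn) (unbridged-acyclic S acyc) , x∈p∪⁅x⁆ e S

  bridge-unbridge : ∀ S .conn .acyc → bridge (unbridge S conn acyc) ≡ mkST (inside ∷ inside ∷ S) conn acyc
  bridge-unbridge S conn acyc = mkST-cong (cong (λ S′ → inside ∷ inside ∷ S′) (p∪⁅x⁆-x≡p S e∉S))
    where
    e∉S : e ∉ S
    e∉S e∈S = Irrelevant.⊥-elim (bridged-acyclic⇒e∉ acyc e∈S)

  unbridge-bridge : ∀ T .conn .acyc (e∈T : e ∈ T) →
    unbridge (T - e) (bridged-connected T conn) (bridged-acyclic T e∈T acyc) ≡ (mkST T conn acyc , e∈T)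
  unbridge-bridge T conn acyc e∈T = SpanningTreeWith-≡ (mkST-cong (p-x∪⁅x⁆≡p T e∈T))

  split : SpanningTree G′ → (Fin 2 × SpanningTree G) ⊎ SpanningTreeWith G e
  split (mkST (inside  ∷ outside ∷ S) conn acyc) = inj₁ (zero , removePendant zero S conn acyc)
  split (mkST (outside ∷ inside  ∷ S) conn acyc) = inj₁ (suc zero , removePendant (suc zero) S conn acyc)
  split (mkST (inside  ∷ inside  ∷ S) conn acyc) = inj₂ (unbridge S conn acyc)
  split (mkST (outside ∷ outside ∷ S) conn acyc) = Irrelevant.⊥-elim (w-unreachable (conn w (ι u)))

  join : (Fin 2 × SpanningTree G) ⊎ SpanningTreeWith G e → SpanningTree G′
  join (inj₁ (c , T)) = addPendant c T
  join (inj₂ X)       = bridge X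

  SpanningTree-addVertex-↔ : SpanningTree G′ ↔ ((Fin 2 × SpanningTree G) ⊎ SpanningTreeWith G e)
  SpanningTree-addVertex-↔ = mk↔ₛ′ split join split-join join-split
    where
    split-join : ∀ Y → split (join Y) ≡ Y
    split-join (inj₁ (zero     , mkST S _ _)) = refl
    split-join (inj₁ (suc zero , mkST S _ _)) = refl
    split-join (inj₂ (mkST T conn acyc , e∈T)) = cong inj₂ (unbridge-bridge T conn acyc e∈T)

    join-split : ∀ X → join (split X) ≡ X
    join-split (mkST (inside  ∷ outside ∷ S) conn acyc) = refl
    join-split (mkST (outside ∷ inside  ∷ S) conn acyc) = refl
    join-split (mkST (inside  ∷ inside  ∷ S) conn acyc) = bridge-unbridge S conn acyc
    join-split (mkST (outside ∷ outside ∷ S) conn acyc) = Irrelevant.⊥-elim (w-unreachable (conn w (ι u)))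

  newEdge∈pendant : ∀ c {S} → newEdge {G} {e} c ∈ pendant c S
  newEdge∈pendant zero       = here
  newEdge∈pendant (suc zero) = there here

  newEdge∈bridged : ∀ c {S} → newEdge {G} {e} c ∈ inside ∷ inside ∷ S
  newEdge∈bridged zero       = here
  newEdge∈bridged (suc zero) = there here

  splitWith : ∀ c → SpanningTreeWith G′ (newEdge {G} {e} c) → SpanningTree G ⊎ SpanningTreeWith G e
  splitWith zero (mkST (inside ∷ outside ∷ S) conn acyc , here) = inj₁ (removePendant zero S conn acyc)
  splitWith zero (mkST (inside ∷ inside  ∷ S) conn acyc , here) = inj₂ (unbridge S conn acyc)
  splitWith (suc zero) (mkST (outside ∷ inside ∷ S) conn acyc , there here) =
    inj₁ (removePendant (suc zero) S conn acyc)
  splitWith (suc zero) (mkST (inside ∷ inside ∷ S) conn acyc , there here) = inj₂ (unbridge S conn acyc)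

  joinWith : ∀ c → SpanningTree G ⊎ SpanningTreeWith G e → SpanningTreeWith G′ (newEdge {G} {e} c)
  joinWith c (inj₁ (mkST S conn acyc)) = addPendant c (mkST S conn acyc) , newEdge∈pendant c
  joinWith c (inj₂ (mkST T conn acyc , e∈T)) = bridge (mkST T conn acyc , e∈T) , newEdge∈bridged c

  SpanningTreeWith-newEdge-↔ : ∀ c →
    SpanningTreeWith G′ (newEdge {G} {e} c) ↔ (SpanningTree G ⊎ SpanningTreeWith G e)
  SpanningTreeWith-newEdge-↔ c =
    mk↔ₛ′ (splitWith c) (joinWith c) (splitWith-joinWith c) (joinWith-splitWith c)
    where
    splitWith-joinWith : ∀ c Y → splitWith c (joinWith c Y) ≡ Y
    splitWith-joinWith zero       (inj₁ (mkST S _ _)) = refl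
    splitWith-joinWith (suc zero) (inj₁ (mkST S _ _)) = refl
    splitWith-joinWith zero       (inj₂ (mkST T conn acyc , e∈T)) = cong inj₂ (unbridge-bridge T conn acyc e∈T)
    splitWith-joinWith (suc zero) (inj₂ (mkST T conn acyc , e∈T)) = cong inj₂ (unbridge-bridge T conn acyc e∈T)

    joinWith-splitWith : ∀ c X → joinWith c (splitWith c X) ≡ X
    joinWith-splitWith zero       (mkST (inside  ∷ outside ∷ S) conn acyc , here)       = refl
    joinWith-splitWith zero       (mkST (inside  ∷ inside  ∷ S) conn acyc , here)       =
      SpanningTreeWith-≡ (bridge-unbridge S conn acyc)
    joinWith-splitWith (suc zero) (mkST (outside ∷ inside  ∷ S) conn acyc , there here) = refl
    joinWith-splitWith (suc zero) (mkST (inside  ∷ inside  ∷ S) conn acyc , there here) =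
      SpanningTreeWith-≡ (bridge-unbridge S conn acyc)

Counts : Σ Graph Edge → ℕ × ℕ → Set
Counts (G , e) (t , s) = NumSpanningTrees G t × NumSpanningTreesWith G e s

stepCounts : ℕ × ℕ → ℕ × ℕ
stepCounts (t , s) = 2 * t + s , t + s

addVertex-counts : ∀ {G e} ts → Counts (G , e) ts →
  ∀ c → Counts (addVertex G e , newEdge {G} {e} c) (stepCounts ts)
addVertex-counts {G} {e} (t , s) (trees , treesWith) c =
  ↔-trans +↔⊎ (↔-trans (*↔× ⊎-↔ ↔-refl)
    (↔-trans ((↔-refl ×-↔ trees) ⊎-↔ treesWith) (↔-sym SpanningTree-addVertex-↔))) ,
  ↔-trans +↔⊎ (↔-trans (trees ⊎-↔ treesWith) (↔-sym (SpanningTreeWith-newEdge-↔ c)))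
  where open AddVertex G e

chain-counts : ∀ {G e p} ts → Counts (G , e) ts →
  (cs : Vec (Fin 2) p) → Counts (chain G e cs) (iterate stepCounts ts p)
chain-counts ts counts []       = counts
chain-counts ts counts (c ∷ cs) = chain-counts (stepCounts ts) (addVertex-counts ts counts c) cs

fibCounts : ℕ → ℕ → ℕ → ℕ × ℕ
fibCounts m α β = F (suc (suc m)) * α + F (suc m) * β , F (suc m) * α + F m * β

stepCounts-fibCounts : ∀ m α β → stepCounts (fibCounts m α β) ≡ fibCounts (2 + m) α β
stepCounts-fibCounts m α β = cong₂ _,_ (trees α β (F (suc m)) (F m)) (treesWith α β (F (suc m)) (F m))
  where
  trees : ∀ α β a b →
    2 * ((a + b) * α + a * β) + (a * α + b * β) ≡ ((a + b + a) + (a + b)) * α + (a + b + a) * β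
  trees = solve-∀
  treesWith : ∀ α β a b → ((a + b) * α + a * β) + (a * α + b * β) ≡ (a + b + a) * α + (a + b) * β
  treesWith = solve-∀

iterate-stepCounts : ∀ k m α β → iterate stepCounts (fibCounts m α β) k ≡ fibCounts (2 * k + m) α β
iterate-stepCounts zero    m α β = refl
iterate-stepCounts (suc k) m α β = begin
  iterate stepCounts (stepCounts (fibCounts m α β)) k
    ≡⟨ cong (λ ts → iterate stepCounts ts k) (stepCounts-fibCounts m α β) ⟩
  iterate stepCounts (fibCounts (2 + m) α β) k        ≡⟨ iterate-stepCounts k (2 + m) α β ⟩
  fibCounts (2 * k + (2 + m)) α β                     ≡⟨ cong (λ n → fibCounts n α β) (index k m) ⟩
  fibCounts (2 * suc k + m) α β                       ∎
  where
  open ≡-Reasoning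
  index : ∀ k m → 2 * k + (2 + m) ≡ 2 * suc k + m
  index = solve-∀

-- p ≥ 1 is needed: at p = 0 the truncated 2 * p ∸ 1 would give F 0 = 0 where F (-1) = 1 is meant.
counts-closed-form : ∀ p → p ≥ 1 → ∀ α β →
  iterate stepCounts (α , β) p ≡ (F (2 * p + 1) * α + F (2 * p) * β , F (2 * p) * α + F (2 * p ∸ 1) * β)
counts-closed-form (suc k) _ α β = begin
  iterate stepCounts (stepCounts (α , β)) k ≡⟨ cong (λ ts → iterate stepCounts ts k) (first-step α β) ⟩
  iterate stepCounts (fibCounts 1 α β) k    ≡⟨ iterate-stepCounts k 1 α β ⟩
  fibCounts (2 * k + 1) α β
    ≡⟨ cong₂ (λ a b → F a * α + F b * β , F b * α + F (b ∸ 1) * β) (odd k) (even k) ⟨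
  _                                          ∎
  where
  open ≡-Reasoning
  first-step : ∀ α β → stepCounts (α , β) ≡ fibCounts 1 α β
  first-step α β = cong₂ _,_ (trees α β) (treesWith α β)
    where
    trees : ∀ α β → 2 * α + β ≡ 2 * α + 1 * β
    trees = solve-∀
    treesWith : ∀ α β → α + β ≡ 1 * α + 1 * β
    treesWith = solve-∀
  odd : ∀ k → 2 * suc k + 1 ≡ suc (suc (2 * k + 1))
  odd = solve-∀
  even : ∀ k → 2 * suc k ≡ suc (2 * k + 1)
  even = solve-∀

theorem3p5 : (H : Graph) → TwoTree H → (e₀ : Edge H) → (α β : ℕ) →
    NumSpanningTrees H α → NumSpanningTreesWith H e₀ β →
    (p : ℕ) → p ≥ 1 → (cs : Vec (Fin 2) p) →
    NumSpanningTrees (proj₁ (chain H e₀ cs)) (F (2 * p + 1) * α + F (2 * p) * β)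
    × NumSpanningTreesWith (proj₁ (chain H e₀ cs)) (proj₂ (chain H e₀ cs)) (F (2 * p) * α + F (2 * p ∸ 1) * β)
theorem3p5 H _ e₀ α β trees treesWith p p≥1 cs =
  subst (Counts (chain H e₀ cs)) (counts-closed-form p p≥1 α β) (chain-counts (α , β) (trees , treesWith) cs)
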